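{- Let $p>3$ be a prime and let $j\in\{2,3,\ldots,p-1\}$. Define $$M_p(j)=\Big\{\, i\in\{1,2,\ldots,\tfrac{p-1}{2}\} \;:\; i<\{ij\}_p<\tfrac{p}{2}\Big\}.$$ Then $$|M_p(j)|\equiv \frac{\big(\frac{1-j}{p}\big)-1}{2}+\frac{p^2-1}{8}\pmod 2,$$ which amounts to: $\big(\frac{j-1}{p}\big)=(-1)^{|M_p(j)|}$ when $p\equiv 1,3\pmod 8$, and $\big(\frac{j-1}{p}\big)=(-1)^{|M_p(j)|+1}$ when $p\equiv 5,7\pmod 8$.
   Context: For an integer $x$, $\{x\}_p$ denotes the least nonnegative residue of $x$ modulo $p$. $\big(\frac{\cdot}{p}\big)$ is the Legendre symbol and $|A|$ is the cardinality of a set $A$. -}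

module Defs where

open import Data.Nat using (ℕ; zero; suc; _+_; _*_; _∸_; _<_; _≡ᵇ_; _<ᵇ_; NonZero)
open import Data.Nat.DivMod using (_%_; _/_)
open import Data.Bool using (Bool; true; false; _∧_; _∨_; if_then_else_)
open import Data.List using (List; length; filterᵇ; upTo; map)
open import Data.Bool.ListAction using (any)
open import Data.Integer using (ℤ; +_; -_)

res : (x p : ℕ) → .{{NonZero p}} → ℕ
res x p = x % p

isSquareMod : (a p : ℕ) → .{{NonZero p}} → Bool
isSquareMod a p = any (λ x → ((x * x) % p) ≡ᵇ (a % p)) (upTo p)

legendre : (a p : ℕ) → .{{NonZero p}} → ℤ
legendre a p =
  if (a % p) ≡ᵇ 0 then + 0
  else if isSquareMod a p then + 1 else - (+ 1)

-- M_p(j) = { i ∈ {1,…,(p-1)/2} : i < {ij}_p < p/2 }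
-- ({ij}_p < p/2  ⇔  2·{ij}_p < p)
Mp : (p j : ℕ) → .{{NonZero p}} → List ℕ
Mp p j = filterᵇ (λ i → (i <ᵇ res (i * j) p) ∧ ((2 * res (i * j) p) <ᵇ p))
                 (map suc (upTo ((p ∸ 1) / 2)))

-- Write p = 2n + 1, j = c + 1 with 1 ≤ c < 2n, and a = p - c ≡ 1 - j (mod p).
-- For a unit b let r_b(x) = {xb}_p, G_b = #{x ≤ n : r_b(x) > p/2} and
-- S_b = ∑_{x ≤ n} ⌊xb/p⌋.  Gauss's lemma gives (b/p) = (-1)^G_b, and reducing
-- b·∑x = ∑ r_b(x) + p·S_b modulo 2 gives b·N ≡ N + G_b + S_b, where
-- N = 1 + ⋯ + n = (p² - 1)/8.  Every x ≤ n is exactly one of: a descent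
-- (r_j(x) < x), an element of M_p(j), or counted by G_j; as xj = xc + x, the
-- descents are exactly the x where ⌊xj/p⌋ exceeds ⌊xc/p⌋; and r_a(x) = p - r_c(x)
-- gives G_c + G_a = n.  Combining these modulo 2 yields |M_p(j)| + G_a ≡ N,
-- which is the theorem because (a/p) = (-1)^G_a.
module Submission where

open import Defs
open import Data.Nat using (ℕ; _<_; _≤_; _+_; _*_; _∸_; NonZero)
open import Data.Nat.DivMod using (_/_)
open import Data.Nat.Primality using (Prime)
open import Data.List using (length)
open import Data.Integer using (ℤ; +_) renaming (_+_ to _+ℤ_; _-_ to _-ℤ_)
open import Data.Integer.DivMod using (_/ℕ_)
open import Data.Integer.Divisibility using (_∣_)

open import Data.Nat using (zero; suc; _^_; _<ᵇ_; z≤n; s≤s; s≤s⁻¹; nonTrivial⇒n>1)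
open import Data.Nat.Properties
open import Data.Nat.DivMod
  using (_%_; m%n<n; m%n%n≡m%n; m≡m%n+[m/n]*n; [m+kn]%n≡m%n; m<n⇒m%n≡m; m*n%n≡0; m<n⇒m/n≡0; m*n/n≡m;
         %-distribˡ-+; %-distribˡ-*; +-distrib-/)
open import Data.Nat.Divisibility using (divides; _∣0; ∣-refl; n∣m*n; ∣⇒≤; m%n≡0⇒n∣m) renaming (_∣_ to _∣ℕ_)
open import Data.Nat.Primality using (euclidsLemma; prime⇒nonTrivial; prime⇒irreducible)
open import Data.Nat.ListAction using (sum; product)
open import Data.Nat.ListAction.Properties using (sum-↭; sum-++; product-↭; product-++)
open import Data.Nat.Tactic.RingSolver using (solve-∀)
open import Data.Integer using (∣_∣; -_)
import Data.Integer.Properties as ℤ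
import Data.Integer.Tactic.RingSolver as ℤ-Solver
open import Data.Bool using (Bool; true; false; not; if_then_else_; T; _∧_)
open import Data.Unit using (tt)
open import Data.Empty using (⊥-elim)
open import Data.Product using (∃; _×_; _,_; proj₁; proj₂)
open import Data.Sum using (_⊎_; inj₁; inj₂; [_,_])
open import Data.List using (List; []; _∷_; _++_; _∷ʳ_; map; filterᵇ; upTo; applyUpTo)
open import Data.List.Properties
  using (map-id; map-cong; map-cong-local; length-map; map-applyUpTo; map-upTo; length-upTo; upTo-∷ʳ; map-++)
open import Data.List.Membership.Propositional using (_∈_; lose)
open import Data.List.Membership.Propositional.Properties using (∈-map⁺; ∈-map⁻; ∈-∃++; ∈-upTo⁺; ∈-upTo⁻)
open import Data.List.Relation.Unary.Any using (here; there; satisfied)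
open import Data.List.Relation.Unary.Any.Properties using (any⁺; any⁻)
import Data.List.Relation.Unary.All as All
open import Data.List.Relation.Unary.AllPairs as AllPairs using ([]; _∷_)
open import Data.List.Relation.Unary.Unique.Propositional using (Unique)
open import Data.List.Relation.Unary.Unique.Propositional.Properties using (map⁺; upTo⁺)
open import Data.List.Relation.Binary.Permutation.Propositional
  using (_↭_; ↭-refl; ↭-sym; ↭-trans; ↭-prep; ↭⇒↭ₛ′)
open import Data.List.Relation.Binary.Permutation.Propositional.Properties using (shift; ∈-resp-↭; ↭-length)
open import Data.List.Relation.Binary.Permutation.Setoid.Properties using (Unique-resp-↭)
open import Function using (id; _∘_)
open import Relation.Nullary using (¬_; contradiction)
open import Relation.Binary.Bundles using (Setoid)
open import Relation.Binary.Structures using (IsEquivalence)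
open import Relation.Binary.Definitions using (tri<; tri≈; tri>)
open import Relation.Binary.PropositionalEquality hiding ([_])
import Relation.Binary.Reasoning.Setoid

<ᵇ-true : ∀ {m n} → m < n → (m <ᵇ n) ≡ true
<ᵇ-true {m} {n} m<n with m <ᵇ n | <⇒<ᵇ m<n
... | true | _ = refl

<ᵇ-false : ∀ {m n} → n ≤ m → (m <ᵇ n) ≡ false
<ᵇ-false {m} {n} n≤m with m <ᵇ n in m<ᵇn
... | false = refl
... | true  = contradiction (<ᵇ⇒< m n (subst T (sym m<ᵇn) tt)) (≤⇒≯ n≤m)

𝟙 : Bool → ℕ
𝟙 b = if b then 1 else 0

parity : ∀ g → g % 2 ≡ 0 ⊎ g % 2 ≡ 1
parity g with g % 2 | m%n<n g 2
... | 0 | _ = inj₁ refl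
... | 1 | _ = inj₂ refl
... | suc (suc _) | s≤s (s≤s ())

divmod-unique : ∀ {d} .{{_ : NonZero d}} r q → r < d → (r + q * d) / d ≡ q × (r + q * d) % d ≡ r
divmod-unique {d} r q r<d = quotient≡q , trans ([m+kn]%n≡m%n r q d) (m<n⇒m%n≡m r<d)
  where
  quotient≡q : (r + q * d) / d ≡ q
  quotient≡q = begin
    (r + q * d) / d   ≡⟨ +-distrib-/ r (q * d) no-carry ⟩
    r / d + q * d / d ≡⟨ cong₂ _+_ (m<n⇒m/n≡0 r<d) (m*n/n≡m q d) ⟩
    q                 ∎
    where
    open ≡-Reasoning
    no-carry : r % d + q * d % d < d
    no-carry = subst (_< d) (sym (cong₂ _+_ (m<n⇒m%n≡m r<d) (m*n%n≡0 q d))) (subst (_< d) (sym (+-identityʳ r)) r<d)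

-- Adding x < d to m raises ⌊m/d⌋ by one exactly when the remainder of m + x
-- wraps around to a value below x.
/-step : ∀ d .{{_ : NonZero d}} m x → x < d → (m + x) / d ≡ m / d + 𝟙 ((m + x) % d <ᵇ x)
/-step d m x x<d = by-cases (<-≤-connex (r + x) d)
  where
  open ≡-Reasoning
  r = m % d
  q = m / d
  decompose : m + x ≡ r + x + q * d
  decompose = trans (cong (_+ x) (m≡m%n+[m/n]*n m d)) (swap r (q * d) x)
    where
    swap : ∀ a b c → a + b + c ≡ a + c + b
    swap = solve-∀
  by-cases : r + x < d ⊎ d ≤ r + x → (m + x) / d ≡ q + 𝟙 ((m + x) % d <ᵇ x)
  -- no wrap-around: the remainder is r + x ≥ x and the quotient stays q
  by-cases (inj₁ r+x<d) = begin
    (m + x) / d              ≡⟨ cong (_/ d) decompose ⟩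
    (r + x + q * d) / d      ≡⟨ proj₁ (divmod-unique (r + x) q r+x<d) ⟩
    q                        ≡⟨ +-identityʳ q ⟨
    q + 𝟙 false              ≡⟨ cong (λ b → q + 𝟙 b) (<ᵇ-false (≤-trans (m≤n+m x r) (≤-reflexive (sym remainder≡)))) ⟨
    q + 𝟙 ((m + x) % d <ᵇ x) ∎
    where
    remainder≡ : (m + x) % d ≡ r + x
    remainder≡ = trans (cong (_% d) decompose) (proj₂ (divmod-unique (r + x) q r+x<d))
  -- wrap-around: the remainder is t = r + x - d < x and the quotient is q + 1
  by-cases (inj₂ d≤r+x) = begin
    (m + x) / d              ≡⟨ cong (_/ d) decompose′ ⟩
    (t + suc q * d) / d      ≡⟨ proj₁ (divmod-unique t (suc q) t<d) ⟩
    suc q                    ≡⟨ +-comm 1 q ⟩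
    q + 𝟙 true              ≡⟨ cong (λ b → q + 𝟙 b) (<ᵇ-true (subst (_< x) (sym remainder≡) t<x)) ⟨
    q + 𝟙 ((m + x) % d <ᵇ x) ∎
    where
    t = r + x ∸ d
    t+d≡r+x : t + d ≡ r + x
    t+d≡r+x = m∸n+n≡m d≤r+x
    t<x : t < x
    t<x = +-cancelʳ-< d t x (subst (_< x + d) (sym t+d≡r+x) (subst (r + x <_) (+-comm d x) (+-monoˡ-< x (m%n<n m d))))
    t<d : t < d
    t<d = <-trans t<x x<d
    decompose′ : m + x ≡ t + suc q * d
    decompose′ = trans decompose (trans (cong (_+ q * d) (sym t+d≡r+x)) (+-assoc t d (q * d)))
    remainder≡ : (m + x) % d ≡ t
    remainder≡ = trans (cong (_% d) decompose′) (proj₂ (divmod-unique t (suc q) t<d))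

∑ : List ℕ → (ℕ → ℕ) → ℕ
∑ L f = sum (map f L)

∏ : List ℕ → (ℕ → ℕ) → ℕ
∏ L f = product (map f L)

∑-cong : ∀ {f g} L → (∀ {x} → x ∈ L → f x ≡ g x) → ∑ L f ≡ ∑ L g
∑-cong L f≡g = cong sum (map-cong-local (All.tabulate f≡g))

∑-+ : ∀ f g L → ∑ L (λ x → f x + g x) ≡ ∑ L f + ∑ L g
∑-+ f g []      = refl
∑-+ f g (x ∷ L) = begin
  f x + g x + ∑ L (λ x → f x + g x) ≡⟨ cong (_+_ (f x + g x)) (∑-+ f g L) ⟩
  f x + g x + (∑ L f + ∑ L g)       ≡⟨ +-exchange (f x) (g x) (∑ L f) (∑ L g) ⟩
  f x + ∑ L f + (g x + ∑ L g)       ∎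
  where
  open ≡-Reasoning
  +-exchange : ∀ a b c d → a + b + (c + d) ≡ a + c + (b + d)
  +-exchange = solve-∀

∑-*ˡ : ∀ c f L → ∑ L (λ x → c * f x) ≡ c * ∑ L f
∑-*ˡ c f []      = sym (*-zeroʳ c)
∑-*ˡ c f (x ∷ L) = trans (cong (_+_ (c * f x)) (∑-*ˡ c f L)) (sym (*-distribˡ-+ c (f x) (∑ L f)))

∑-count : ∀ L → ∑ L (λ _ → 1) ≡ length L
∑-count []      = refl
∑-count (x ∷ L) = cong suc (∑-count L)

length-filter : ∀ (P : ℕ → Bool) L → length (filterᵇ P L) ≡ ∑ L (λ x → 𝟙 (P x))
length-filter P []      = refl
length-filter P (x ∷ L) with P x
... | true  = cong suc (length-filter P L)
... | false = length-filter P L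

∏-* : ∀ f g L → ∏ L (λ x → f x * g x) ≡ ∏ L f * ∏ L g
∏-* f g []      = refl
∏-* f g (x ∷ L) = begin
  f x * g x * ∏ L (λ x → f x * g x) ≡⟨ cong ((f x * g x) *_) (∏-* f g L) ⟩
  f x * g x * (∏ L f * ∏ L g)       ≡⟨ [m*n]*[o*p]≡[m*o]*[n*p] (f x) (g x) (∏ L f) (∏ L g) ⟩
  f x * ∏ L f * (g x * ∏ L g)       ∎
  where open ≡-Reasoning

∏-const : ∀ c L → ∏ L (λ _ → c) ≡ c ^ length L
∏-const c []      = refl
∏-const c (x ∷ L) = cong (c *_) (∏-const c L)

∏-scale : ∀ b L → ∏ L (λ x → x * b) ≡ product L * b ^ length L
∏-scale b L = begin
  ∏ L (λ x → x * b)        ≡⟨ ∏-* id (λ _ → b) L ⟩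
  ∏ L id * ∏ L (λ _ → b)   ≡⟨ cong₂ _*_ (cong product (map-id L)) (∏-const b L) ⟩
  product L * b ^ length L ∎
  where open ≡-Reasoning

∏-indicator : ∀ c (g : ℕ → Bool) L →
  ∏ L (λ x → if g x then 1 else c) ≡ c ^ ∑ L (λ x → 𝟙 (not (g x)))
∏-indicator c g []      = refl
∏-indicator c g (x ∷ L) with g x
... | true  = trans (+-identityʳ _) (∏-indicator c g L)
... | false = cong (c *_) (∏-indicator c g L)

⊆∧length⇒↭ : ∀ {xs ys : List ℕ} → Unique xs → (∀ {x} → x ∈ xs → x ∈ ys) →
             length ys ≤ length xs → xs ↭ ys
⊆∧length⇒↭ {[]}     {[]}     _ _ _ = ↭-refl
⊆∧length⇒↭ {x ∷ xs} {ys} (x∉xs ∷ xs-unique) xs⊆ys ys≤xs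
  with hs , ts , refl ← ∈-∃++ (xs⊆ys (here refl)) =
  ↭-trans (↭-prep x (⊆∧length⇒↭ xs-unique xs⊆hs++ts shorter)) (↭-sym (shift x hs ts))
  where
  xs⊆hs++ts : ∀ {z} → z ∈ xs → z ∈ hs ++ ts
  xs⊆hs++ts {z} z∈xs with ∈-resp-↭ (shift x hs ts) (xs⊆ys (there z∈xs))
  ... | here z≡x = contradiction (sym z≡x) (All.lookup x∉xs z∈xs)
  ... | there z∈ = z∈
  shorter : length (hs ++ ts) ≤ length xs
  shorter = s≤s⁻¹ (subst (_≤ suc (length xs)) (↭-length (shift x hs ts)) ys≤xs)

map-unique : ∀ (f : ℕ → ℕ) {L} → Unique L →
  (∀ {x y} → x ∈ L → y ∈ L → f x ≡ f y → x ≡ y) → Unique (map f L)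
map-unique f {[]}    []                 _     = []
map-unique f {x ∷ L} (x∉L ∷ L-unique) f-inj =
  All.tabulate fx≢ ∷ map-unique f L-unique (λ x∈ y∈ → f-inj (there x∈) (there y∈))
  where
  fx≢ : ∀ {z} → z ∈ map f L → f x ≢ z
  fx≢ z∈ fx≡z with y , y∈L , refl ← ∈-map⁻ f z∈ = All.lookup x∉L y∈L (f-inj (here refl) (there y∈L) fx≡z)

injection⇒↭ : ∀ (f : ℕ → ℕ) {L} → Unique L → (∀ {x} → x ∈ L → f x ∈ L) →
  (∀ {x y} → x ∈ L → y ∈ L → f x ≡ f y → x ≡ y) → map f L ↭ L
injection⇒↭ f {L} L-unique f-into f-inj =
  ⊆∧length⇒↭ (map-unique f L-unique f-inj) image⊆L (≤-reflexive (sym (length-map f L)))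
  where
  image⊆L : ∀ {z} → z ∈ map f L → z ∈ L
  image⊆L z∈ with y , y∈L , refl ← ∈-map⁻ f z∈ = f-into y∈L

unique-↭ : ∀ {xs ys : List ℕ} → xs ↭ ys → Unique xs → Unique ys
unique-↭ xs↭ys = Unique-resp-↭ (setoid ℕ) (↭⇒↭ₛ′ isEquivalence xs↭ys)

interval : ℕ → ℕ → List ℕ
interval a k = map (_+_ a) (upTo k)

∈-interval⁻ : ∀ {a k x} → x ∈ interval a k → a ≤ x × x < a + k
∈-interval⁻ {a} x∈ with i , i∈ , refl ← ∈-map⁻ (_+_ a) x∈ = m≤m+n a i , +-monoʳ-< a (∈-upTo⁻ i∈)

∈-interval⁺ : ∀ {a k x} → a ≤ x → x < a + k → x ∈ interval a k
∈-interval⁺ {a} {k} {x} a≤x x<a+k =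
  subst (_∈ interval a k) (m+[n∸m]≡n a≤x) (∈-map⁺ (_+_ a) (∈-upTo⁺ x∸a<k))
  where
  x∸a<k : x ∸ a < k
  x∸a<k = +-cancelˡ-< a (x ∸ a) k (subst (_< a + k) (sym (m+[n∸m]≡n a≤x)) x<a+k)

interval-unique : ∀ a k → Unique (interval a k)
interval-unique a k = map⁺ (+-cancelˡ-≡ a _ _) (upTo⁺ k)

length-interval : ∀ a k → length (interval a k) ≡ k
length-interval a k = trans (length-map (_+_ a) (upTo k)) (length-upTo k)

interval-∷ : ∀ a k → interval a (suc k) ≡ a ∷ interval (suc a) k
interval-∷ a k = cong₂ _∷_ (+-identityʳ a) (begin
  map (_+_ a) (applyUpTo suc k)  ≡⟨ map-applyUpTo suc (_+_ a) k ⟩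
  applyUpTo (λ i → a + suc i) k ≡⟨ map-upTo (λ i → a + suc i) k ⟨
  map (λ i → a + suc i) (upTo k) ≡⟨ map-cong (λ i → +-suc a i) (upTo k) ⟩
  interval (suc a) k            ∎)
  where open ≡-Reasoning

interval-∷ʳ : ∀ a k → interval a (suc k) ≡ interval a k ∷ʳ (a + k)
interval-∷ʳ a k = trans (cong (map (_+_ a)) (sym (upTo-∷ʳ k))) (map-++ (_+_ a) (upTo k) (k ∷ []))

2*∑interval : ∀ n → 2 * sum (interval 1 n) ≡ n * suc n
2*∑interval zero    = refl
2*∑interval (suc n) = begin
  2 * sum (interval 1 (suc n))                ≡⟨ cong (λ l → 2 * sum l) (interval-∷ʳ 1 n) ⟩
  2 * sum (interval 1 n ++ suc n ∷ [])        ≡⟨ cong (2 *_) (sum-++ (interval 1 n) (suc n ∷ [])) ⟩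
  2 * (sum (interval 1 n) + (suc n + 0))      ≡⟨ *-distribˡ-+ 2 (sum (interval 1 n)) (suc n + 0) ⟩
  2 * sum (interval 1 n) + 2 * (suc n + 0)    ≡⟨ cong (_+ 2 * (suc n + 0)) (2*∑interval n) ⟩
  n * suc n + 2 * (suc n + 0)                 ≡⟨ step n ⟩
  suc n * suc (suc n)                         ∎
  where
  open ≡-Reasoning
  step : ∀ n → n * suc n + 2 * (suc n + 0) ≡ suc n * suc (suc n)
  step = solve-∀

module Congruence (m : ℕ) .{{_ : NonZero m}} where

  infix 4 _≋_
  record _≋_ (a b : ℕ) : Set where
    constructor mk≋
    field same-residue : a % m ≡ b % m

  ≋-isEquivalence : IsEquivalence _≋_
  ≋-isEquivalence = record
    { refl  = mk≋ refl
    ; sym   = λ (mk≋ e) → mk≋ (sym e)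
    ; trans = λ (mk≋ e) (mk≋ f) → mk≋ (trans e f)
    }

  ≋-setoid : Setoid _ _
  ≋-setoid = record { isEquivalence = ≋-isEquivalence }

  open IsEquivalence ≋-isEquivalence public
    using () renaming (refl to ≋-refl; sym to ≋-sym; trans to ≋-trans; reflexive to ≋-reflexive)

  module ≋-Reasoning = Relation.Binary.Reasoning.Setoid ≋-setoid

  ≋-+ : ∀ {a b c d} → a ≋ b → c ≋ d → a + c ≋ b + d
  ≋-+ {a} {b} {c} {d} (mk≋ a≋b) (mk≋ c≋d) = mk≋ (begin
    (a + c) % m         ≡⟨ %-distribˡ-+ a c m ⟩
    (a % m + c % m) % m ≡⟨ cong₂ (λ u v → (u + v) % m) a≋b c≋d ⟩
    (b % m + d % m) % m ≡⟨ %-distribˡ-+ b d m ⟨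
    (b + d) % m         ∎)
    where open ≡-Reasoning

  ≋-* : ∀ {a b c d} → a ≋ b → c ≋ d → a * c ≋ b * d
  ≋-* {a} {b} {c} {d} (mk≋ a≋b) (mk≋ c≋d) = mk≋ (begin
    (a * c) % m             ≡⟨ %-distribˡ-* a c m ⟩
    (a % m * (c % m)) % m   ≡⟨ cong₂ (λ u v → (u * v) % m) a≋b c≋d ⟩
    (b % m * (d % m)) % m   ≡⟨ %-distribˡ-* b d m ⟨
    (b * d) % m             ∎)
    where open ≡-Reasoning

  ≋-^ : ∀ {a b} k → a ≋ b → a ^ k ≋ b ^ k
  ≋-^ zero    a≋b = ≋-refl
  ≋-^ (suc k) a≋b = ≋-* a≋b (≋-^ k a≋b)

  %-≋ : ∀ a → a % m ≋ a
  %-≋ a = mk≋ (m%n%n≡m%n a m)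

  +-multiple-≋ : ∀ a k → a + k * m ≋ a
  +-multiple-≋ a k = mk≋ ([m+kn]%n≡m%n a k m)

  ≋-canonical : ∀ {a b} → a < m → b < m → a ≋ b → a ≡ b
  ≋-canonical {a} {b} a<m b<m (mk≋ e) = trans (sym (m<n⇒m%n≡m a<m)) (trans e (m<n⇒m%n≡m b<m))

  ≋⇒∣∸ : ∀ {a b} → a ≤ b → a ≋ b → m ∣ℕ b ∸ a
  ≋⇒∣∸ {a} {b} a≤b (mk≋ e) = divides (b / m ∸ a / m) (begin
    b ∸ a                                     ≡⟨ cong₂ _∸_ (m≡m%n+[m/n]*n b m) (m≡m%n+[m/n]*n a m) ⟩
    (b % m + b / m * m) ∸ (a % m + a / m * m) ≡⟨ cong (λ r → (b % m + b / m * m) ∸ (r + a / m * m)) e ⟩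
    (b % m + b / m * m) ∸ (b % m + a / m * m) ≡⟨ [m+n]∸[m+o]≡n∸o (b % m) _ _ ⟩
    b / m * m ∸ a / m * m                     ≡⟨ *-distribʳ-∸ m (b / m) (a / m) ⟨
    (b / m ∸ a / m) * m                       ∎)
    where open ≡-Reasoning

  ∣∸⇒≋ : ∀ {a b} → a ≤ b → m ∣ℕ b ∸ a → a ≋ b
  ∣∸⇒≋ {a} {b} a≤b (divides k e) = mk≋ (begin
    a % m             ≡⟨ [m+kn]%n≡m%n a k m ⟨
    (a + k * m) % m   ≡⟨ cong (λ d → (a + d) % m) e ⟨
    (a + (b ∸ a)) % m ≡⟨ cong (_% m) (m+[n∸m]≡n a≤b) ⟩
    b % m             ∎)
    where open ≡-Reasoning

  ≋0⇒∣ : ∀ {a} → a ≋ 0 → m ∣ℕ a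
  ≋0⇒∣ a≋0 = ≋⇒∣∸ z≤n (≋-sym a≋0)

  ∣⇒≋0 : ∀ {a} → m ∣ℕ a → a ≋ 0
  ∣⇒≋0 m∣a = ≋-sym (∣∸⇒≋ z≤n m∣a)

  ≋-wlog : {H : ℕ → ℕ → Set} → (∀ {a b} → H a b → H b a) →
           (∀ {a b} → a ≤ b → H a b → a ≋ b) → ∀ {a b} → H a b → a ≋ b
  ≋-wlog H-sym by-≤ {a} {b} h with ≤-total a b
  ... | inj₁ a≤b = by-≤ a≤b h
  ... | inj₂ b≤a = ≋-sym (by-≤ b≤a (H-sym h))

  +-cancelˡ-≋ : ∀ c {a b} → c + a ≋ c + b → a ≋ b
  +-cancelˡ-≋ c = ≋-wlog ≋-sym λ {a} {b} a≤b h →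
    ∣∸⇒≋ a≤b (subst (m ∣ℕ_) ([m+n]∸[m+o]≡n∸o c b a) (≋⇒∣∸ (+-monoʳ-≤ c a≤b) h))

  ≋⇒∣ℤ : ∀ {a b} → a ≋ b → + m ∣ (+ a -ℤ + b)
  ≋⇒∣ℤ {a} {b} a≋b with ≤-total a b
  ... | inj₁ a≤b = subst (m ∣ℕ_) (sym (dist a≤b)) (≋⇒∣∸ a≤b a≋b)
    where
    dist : a ≤ b → ∣ + a -ℤ + b ∣ ≡ b ∸ a
    dist a≤b = trans (cong ∣_∣ (ℤ.m-n≡m⊖n a b)) (ℤ.∣⊖∣-≤ a≤b)
  ... | inj₂ b≤a = subst (m ∣ℕ_) (sym dist) (≋⇒∣∸ b≤a (≋-sym a≋b))
    where
    dist : ∣ + a -ℤ + b ∣ ≡ a ∸ b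
    dist = trans (cong ∣_∣ (ℤ.m-n≡m⊖n a b)) (trans (ℤ.∣m⊖n∣≡∣n⊖m∣ a b) (ℤ.∣⊖∣-≤ b≤a))

  *-cancelʳ-≋ : Prime m → ∀ {a b c} → ¬ (m ∣ℕ c) → a * c ≋ b * c → a ≋ b
  *-cancelʳ-≋ m-prime {c = c} m∤c = ≋-wlog ≋-sym λ {a} {b} a≤b h →
    let m∣[b∸a]*c = subst (m ∣ℕ_) (sym (*-distribʳ-∸ c b a)) (≋⇒∣∸ (*-monoˡ-≤ c a≤b) h)
    in  ∣∸⇒≋ a≤b ([ id , (λ m∣c → contradiction m∣c m∤c) ] (euclidsLemma (b ∸ a) c m-prime m∣[b∸a]*c))

  ∏-≋ : ∀ {f g} L → (∀ {x} → x ∈ L → f x ≋ g x) → ∏ L f ≋ ∏ L g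
  ∏-≋ []      f≋g = ≋-refl
  ∏-≋ (x ∷ L) f≋g = ≋-* (f≋g (here refl)) (∏-≋ L (λ x∈ → f≋g (there x∈)))

  ∑-≋ : ∀ {f g} L → (∀ {x} → x ∈ L → f x ≋ g x) → ∑ L f ≋ ∑ L g
  ∑-≋ []      f≋g = ≋-refl
  ∑-≋ (x ∷ L) f≋g = ≋-+ (f≋g (here refl)) (∑-≋ L (λ x∈ → f≋g (there x∈)))

  record Pairing (c : ℕ) (L : List ℕ) : Set where
    field
      partner     : ℕ → ℕ
      partner-∈   : ∀ {x} → x ∈ L → partner x ∈ L
      partner-≢   : ∀ {x} → x ∈ L → partner x ≢ x
      involutive  : ∀ {x} → x ∈ L → partner (partner x) ≡ x
      partner-*   : ∀ {x} → x ∈ L → x * partner x ≋ c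

  remove-pair : ∀ {c x y hs ts} (P : Pairing c (x ∷ hs ++ y ∷ ts)) → Pairing.partner P x ≡ y →
                Unique (x ∷ hs ++ y ∷ ts) → Pairing c (hs ++ ts)
  remove-pair {c} {x} {y} {hs} {ts} P px≡y (x∉ ∷ rest-unique) = record
    { partner    = partner
    ; partner-∈  = stays
    ; partner-≢  = λ z∈ → partner-≢ (widen z∈)
    ; involutive = λ z∈ → involutive (widen z∈)
    ; partner-*  = λ z∈ → partner-* (widen z∈)
    }
    where
    open Pairing P
    y∉ : All.All (y ≢_) (hs ++ ts)
    y∉ = AllPairs.head (unique-↭ (shift y hs ts) rest-unique)
    widen : ∀ {z} → z ∈ hs ++ ts → z ∈ x ∷ hs ++ y ∷ ts
    widen z∈ = there (∈-resp-↭ (↭-sym (shift y hs ts)) (there z∈))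
    -- the partner of z is neither x (else z = y) nor y (else z = x)
    stays : ∀ {z} → z ∈ hs ++ ts → partner z ∈ hs ++ ts
    stays {z} z∈ with partner-∈ (widen z∈)
    ... | here pz≡x = contradiction y≡z (All.lookup y∉ z∈)
      where
      y≡z : y ≡ z
      y≡z = begin
        y                   ≡⟨ px≡y ⟨
        partner x           ≡⟨ cong partner pz≡x ⟨
        partner (partner z) ≡⟨ involutive (widen z∈) ⟩
        z                   ∎
        where open ≡-Reasoning
    ... | there pz∈ with ∈-resp-↭ (shift y hs ts) pz∈
    ...   | there pz∈rest = pz∈rest
    ...   | here pz≡y = ⊥-elim (All.lookup x∉ (∈-resp-↭ (↭-sym (shift y hs ts)) (there z∈)) (sym z≡x))
      where
      z≡x : z ≡ x
      z≡x = begin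
        z                   ≡⟨ involutive (widen z∈) ⟨
        partner (partner z) ≡⟨ cong partner pz≡y ⟩
        partner y           ≡⟨ cong partner px≡y ⟨
        partner (partner x) ≡⟨ involutive (here refl) ⟩
        x                   ∎
        where open ≡-Reasoning

  pairing-product : ∀ {c} L → Unique L → Pairing c L → ∃ λ k → length L ≡ k + k × product L ≋ c ^ k
  pairing-product L = go (length L) L ≤-refl
    where
    go : ∀ {c} fuel L → length L ≤ fuel → Unique L → Pairing c L →
         ∃ λ k → length L ≡ k + k × product L ≋ c ^ k
    go _          []       _   _ _ = 0 , refl , ≋-refl
    go {c} (suc fuel) (x ∷ xs) len L-unique P
      with Pairing.partner P x in px≡y | Pairing.partner-∈ P (here refl) | Pairing.partner-≢ P (here refl)
    ... | y | here y≡x   | y≢x = contradiction y≡x y≢x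
    ... | y | there y∈xs | _ with hs , ts , refl ← ∈-∃++ y∈xs =
      add-pair (go fuel (hs ++ ts) shorter (AllPairs.tail (unique-↭ (shift y hs ts) (AllPairs.tail L-unique)))
                                           (remove-pair P px≡y L-unique))
      where
      shorter : length (hs ++ ts) ≤ fuel
      shorter = ≤-trans (n≤1+n _) (s≤s⁻¹ (subst (_≤ suc fuel) (cong suc (↭-length (shift y hs ts))) len))
      add-pair : (∃ λ k → length (hs ++ ts) ≡ k + k × product (hs ++ ts) ≋ c ^ k) →
                 ∃ λ k → suc (length (hs ++ y ∷ ts)) ≡ k + k × x * product (hs ++ y ∷ ts) ≋ c ^ k
      add-pair (k , len≡ , prod≋) = suc k , length≡ , product≋
        where
        length≡ : suc (length (hs ++ y ∷ ts)) ≡ suc k + suc k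
        length≡ = cong suc (trans (↭-length (shift y hs ts)) (trans (cong suc len≡) (sym (+-suc k k))))
        product≋ : x * product (hs ++ y ∷ ts) ≋ c * c ^ k
        product≋ = begin
          x * product (hs ++ y ∷ ts)   ≡⟨ cong (x *_) (product-↭ (shift y hs ts)) ⟩
          x * (y * product (hs ++ ts)) ≡⟨ *-assoc x y _ ⟨
          x * y * product (hs ++ ts)   ≈⟨ ≋-* (subst (λ y → x * y ≋ c) px≡y (Pairing.partner-* P (here refl))) prod≋ ⟩
          c * c ^ k                    ∎
          where open ≋-Reasoning

module Mod2 = Congruence 2

infix 4 _≋₂_
_≋₂_ : ℕ → ℕ → Set
_≋₂_ = Mod2._≋_

legendre-parity⇒∣ : ∀ M N G (ℓ : ℤ) → (ℓ ≡ + 1 × G % 2 ≡ 0) ⊎ (ℓ ≡ - (+ 1) × G % 2 ≡ 1) →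
  M + G ≋₂ N → + 2 ∣ (+ M -ℤ (((ℓ -ℤ + 1) /ℕ 2) +ℤ + N))
legendre-parity⇒∣ M N G _ (inj₁ (refl , G-even)) M+G≋N = Mod2.≋⇒∣ℤ (begin
  M       ≡⟨ +-identityʳ M ⟨
  M + 0   ≈⟨ Mod2.≋-+ (Mod2.≋-refl {M}) (Mod2.mk≋ G-even) ⟨
  M + G   ≈⟨ M+G≋N ⟩
  N       ∎)
  where open Mod2.≋-Reasoning
legendre-parity⇒∣ M N G _ (inj₂ (refl , G-odd)) M+G≋N =
  subst (+ 2 ∣_) (sym (shift-one (+ M) (+ N))) (Mod2.≋⇒∣ℤ (begin
    M + 1   ≈⟨ Mod2.≋-+ (Mod2.≋-refl {M}) (Mod2.mk≋ G-odd) ⟨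
    M + G   ≈⟨ M+G≋N ⟩
    N       ∎))
  where
  open Mod2.≋-Reasoning
  shift-one : ∀ x y → x -ℤ (- (+ 1) +ℤ y) ≡ (x +ℤ + 1) -ℤ y
  shift-one = ℤ-Solver.solve-∀

odd-prime⇒1≤n : ∀ {n} → Prime (suc (2 * n)) → 1 ≤ n
odd-prime⇒1≤n {suc _} _      = s≤s z≤n
odd-prime⇒1≤n {zero}  1-prime = contradiction (nonTrivial⇒n>1 1 {{prime⇒nonTrivial 1-prime}}) (λ { (s≤s ()) })

-- Arithmetic modulo an odd prime p = 2n + 1.  The residue 2n plays the role of -1.
module OddPrime (n : ℕ) (p-prime : Prime (suc (2 * n))) where

  p : ℕ
  p = suc (2 * n)

  open Congruence p public

  1≤n : 1 ≤ n
  1≤n = odd-prime⇒1≤n p-prime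

  n<p : n < p
  n<p = s≤s (m≤m+n n (n + 0))

  1<p : 1 < p
  1<p = ≤-trans (s≤s 1≤n) n<p

  2≤2n : 2 ≤ 2 * n
  2≤2n = +-mono-≤ 1≤n (≤-trans 1≤n (m≤m+n n 0))

  units halves : List ℕ
  units  = interval 1 (2 * n)
  halves = interval 1 n

  p²-1/8≡∑halves : (p * p ∸ 1) / 8 ≡ sum halves
  p²-1/8≡∑halves = trans (cong (_/ 8) p²-1≡∑halves*8) (m*n/n≡m (sum halves) 8)
    where
    expand : ∀ n → 2 * n + 2 * n * suc (2 * n) ≡ 4 * (n * suc n)
    expand = solve-∀
    p²-1≡∑halves*8 : p * p ∸ 1 ≡ sum halves * 8
    p²-1≡∑halves*8 = begin
      p * p ∸ 1                  ≡⟨ expand n ⟩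
      4 * (n * suc n)            ≡⟨ cong (4 *_) (2*∑interval n) ⟨
      4 * (2 * sum halves)       ≡⟨ *-assoc 4 2 (sum halves) ⟨
      8 * sum halves             ≡⟨ *-comm 8 (sum halves) ⟩
      sum halves * 8             ∎
      where open ≡-Reasoning

  ∈-units : ∀ {x} → x ∈ units → 1 ≤ x × x < p
  ∈-units = ∈-interval⁻

  ∈-halves : ∀ {x} → x ∈ halves → 1 ≤ x × x ≤ n
  ∈-halves x∈ with 1≤x , x<1+n ← ∈-interval⁻ x∈ = 1≤x , s≤s⁻¹ x<1+n

  halves⊆units : ∀ {x} → x ∈ halves → x ∈ units
  halves⊆units x∈ with 1≤x , x≤n ← ∈-halves x∈ = ∈-interval⁺ 1≤x (≤-trans (s≤s x≤n) n<p)

  p∤ : ∀ {x} → 1 ≤ x → x < p → ¬ (p ∣ℕ x)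
  p∤ {suc x} _ x<p p∣x = <⇒≱ x<p (∣⇒≤ p∣x)

  p∤unit : ∀ {x} → x ∈ units → ¬ (p ∣ℕ x)
  p∤unit x∈ with 1≤x , x<p ← ∈-units x∈ = p∤ 1≤x x<p

  p∤* : ∀ {x y} → ¬ (p ∣ℕ x) → ¬ (p ∣ℕ y) → ¬ (p ∣ℕ x * y)
  p∤* p∤x p∤y p∣xy = [ p∤x , p∤y ] (euclidsLemma _ _ p-prime p∣xy)

  p∤∏ : ∀ L → (∀ {x} → x ∈ L → ¬ (p ∣ℕ x)) → ¬ (p ∣ℕ product L)
  p∤∏ []      _    = p∤ ≤-refl 1<p
  p∤∏ (x ∷ L) p∤L = p∤* (p∤L (here refl)) (p∤∏ L (λ x∈ → p∤L (there x∈)))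

  ∏-cancelˡ-≋ : ∀ L → (∀ {x} → x ∈ L → ¬ (p ∣ℕ x)) → ∀ {a c} → product L * a ≋ product L * c → a ≋ c
  ∏-cancelˡ-≋ L p∤L {a} {c} h =
    *-cancelʳ-≋ p-prime (p∤∏ L p∤L) (≋-trans (≋-reflexive (*-comm a _)) (≋-trans h (≋-reflexive (*-comm _ c))))

  p∤⇒pos : ∀ {x} → ¬ (p ∣ℕ x) → 1 ≤ x
  p∤⇒pos {zero}  p∤0 = contradiction (p ∣0) p∤0
  p∤⇒pos {suc _} _   = s≤s z≤n

  residue-pos : ∀ {a} → ¬ (p ∣ℕ a) → 1 ≤ a % p
  residue-pos {a} p∤a with a % p in a%p≡r
  ... | suc _ = s≤s z≤n
  ... | zero  = contradiction (m%n≡0⇒n∣m a p a%p≡r) p∤a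

  *-injective : ∀ {b x y} → ¬ (p ∣ℕ b) → x < p → y < p → res (x * b) p ≡ res (y * b) p → x ≡ y
  *-injective p∤b x<p y<p e = ≋-canonical x<p y<p (*-cancelʳ-≋ p-prime p∤b (mk≋ e))

  *-permutes-units : ∀ {b} → ¬ (p ∣ℕ b) → map (λ x → res (x * b) p) units ↭ units
  *-permutes-units {b} p∤b = injection⇒↭ (λ x → res (x * b) p) (interval-unique 1 (2 * n)) into
    (λ x∈ y∈ → *-injective p∤b (proj₂ (∈-units x∈)) (proj₂ (∈-units y∈)))
    where
    into : ∀ {x} → x ∈ units → res (x * b) p ∈ units
    into {x} x∈ = ∈-interval⁺ (residue-pos (p∤* (p∤unit x∈) p∤b)) (m%n<n (x * b) p)

  fermat : ∀ {b} → ¬ (p ∣ℕ b) → b ^ (2 * n) ≋ 1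
  fermat {b} p∤b = ∏-cancelˡ-≋ units p∤unit (begin
    product units * b ^ (2 * n)          ≡⟨ cong (λ k → product units * b ^ k) (length-interval 1 (2 * n)) ⟨
    product units * b ^ length units     ≡⟨ ∏-scale b units ⟨
    ∏ units (λ x → x * b)                ≈⟨ ∏-≋ units (λ {x} _ → ≋-sym (%-≋ (x * b))) ⟩
    ∏ units (λ x → res (x * b) p)        ≡⟨ product-↭ (*-permutes-units p∤b) ⟩
    product units                        ≡⟨ *-identityʳ _ ⟨
    product units * 1                    ∎)
    where open ≋-Reasoning

  -- 2n ≋ -1, hence 2n · (p - r) ≋ r.
  minus-one-* : ∀ r → r < p → 2 * n * (p ∸ r) ≋ r
  minus-one-* r r<p = ≋-trans (≋-reflexive expand) (+-multiple-≋ r s)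
    where
    s = 2 * n ∸ r
    r+s≡2n : r + s ≡ 2 * n
    r+s≡2n = m+[n∸m]≡n (s≤s⁻¹ r<p)
    identity : ∀ r s → (r + s) * suc s ≡ r + s * suc (r + s)
    identity = solve-∀
    expand : 2 * n * (p ∸ r) ≡ r + s * p
    expand = begin
      2 * n * (suc (2 * n) ∸ r)   ≡⟨ cong (λ t → t * (suc t ∸ r)) r+s≡2n ⟨
      (r + s) * (suc (r + s) ∸ r) ≡⟨ cong (λ t → (r + s) * (t ∸ r)) (+-suc r s) ⟨
      (r + s) * (r + suc s ∸ r)   ≡⟨ cong ((r + s) *_) (m+n∸m≡n r (suc s)) ⟩
      (r + s) * suc s             ≡⟨ identity r s ⟩
      r + s * suc (r + s)         ≡⟨ cong (λ t → r + s * suc t) r+s≡2n ⟩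
      r + s * p                   ∎
      where open ≡-Reasoning

  minus-one² : 2 * n * (2 * n) ≋ 1
  minus-one² = minus-one-* 1 1<p

  1≉minus-one : ¬ (1 ≋ 2 * n)
  1≉minus-one 1≋2n = <⇒≢ 2≤2n (≋-canonical 1<p ≤-refl 1≋2n)

  -- The quotient c / x modulo p, computed as c · x^(p-2).
  quotient : ℕ → ℕ → ℕ
  quotient c x = res (c * x ^ (2 * n ∸ 1)) p

  quotient<p : ∀ c x → quotient c x < p
  quotient<p c x = m%n<n (c * x ^ (2 * n ∸ 1)) p

  *-quotient : ∀ {c x} → ¬ (p ∣ℕ x) → x * quotient c x ≋ c
  *-quotient {c} {x} p∤x = begin
    x * quotient c x             ≈⟨ ≋-* (≋-refl {x}) (%-≋ (c * x ^ (2 * n ∸ 1))) ⟩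
    x * (c * x ^ (2 * n ∸ 1))    ≡⟨ x*[c*y]≡c*[x*y] x c (x ^ (2 * n ∸ 1)) ⟩
    c * x ^ suc (2 * n ∸ 1)      ≡⟨ cong (λ k → c * x ^ k) (m+[n∸m]≡n (<⇒≤ 2≤2n)) ⟩
    c * x ^ (2 * n)              ≈⟨ ≋-* (≋-refl {c}) (fermat p∤x) ⟩
    c * 1                        ≡⟨ *-identityʳ c ⟩
    c                            ∎
    where
    open ≋-Reasoning
    x*[c*y]≡c*[x*y] : ∀ x c y → x * (c * y) ≡ c * (x * y)
    x*[c*y]≡c*[x*y] = solve-∀

  quotient-p∤ : ∀ {c x} → ¬ (p ∣ℕ c) → ¬ (p ∣ℕ x) → ¬ (p ∣ℕ quotient c x)
  quotient-p∤ {c} {x} p∤c p∤x p∣q = p∤c (≋0⇒∣ (begin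
    c                 ≈⟨ *-quotient p∤x ⟨
    x * quotient c x  ≈⟨ ≋-* (≋-refl {x}) (∣⇒≋0 p∣q) ⟩
    x * 0             ≡⟨ *-zeroʳ x ⟩
    0                 ∎))
    where open ≋-Reasoning

  quotient-involutive : ∀ {c x} → ¬ (p ∣ℕ c) → ¬ (p ∣ℕ x) → x < p → quotient c (quotient c x) ≡ x
  quotient-involutive {c} {x} p∤c p∤x x<p =
    ≋-canonical (quotient<p c y) x<p (*-cancelʳ-≋ p-prime p∤y (begin
      quotient c y * y ≡⟨ *-comm (quotient c y) y ⟩
      y * quotient c y ≈⟨ *-quotient p∤y ⟩
      c                ≈⟨ *-quotient p∤x ⟨
      x * y            ∎))
    where
    open ≋-Reasoning
    y = quotient c x
    p∤y = quotient-p∤ p∤c p∤x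

  quotient-∈units : ∀ {c x} → ¬ (p ∣ℕ c) → ¬ (p ∣ℕ x) → quotient c x ∈ units
  quotient-∈units {c} {x} p∤c p∤x =
    ∈-interval⁺ (p∤⇒pos (quotient-p∤ p∤c p∤x)) (quotient<p c x)

  square-root-of-one : ∀ {x} → 1 ≤ x → x < p → x * x ≋ 1 → x ≡ 1 ⊎ x ≡ 2 * n
  square-root-of-one {suc y} _ x<p x²≋1 with euclidsLemma y (2 + y) p-prime p∣y[y+2]
    where
    factor : ∀ y → (1 + y) * (1 + y) ≡ 1 + y * (2 + y)
    factor = solve-∀
    p∣y[y+2] : p ∣ℕ y * (2 + y)
    p∣y[y+2] = ≋⇒∣∸ (s≤s z≤n) (≋-sym (≋-trans (≋-reflexive (sym (factor y))) x²≋1))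
  ... | inj₂ p∣y+2 = inj₂ (suc-injective (≤-antisym x<p (∣⇒≤ p∣y+2)))
  ... | inj₁ p∣y with y
  ...   | zero   = inj₁ refl
  ...   | suc y′ = contradiction p∣y (p∤ (s≤s z≤n) (<-trans (n<1+n (suc y′)) x<p))

  self-inverse : ∀ {y} → y < p → ¬ (p ∣ℕ y) → y * y ≋ 1 → quotient 1 y ≡ y
  self-inverse {y} y<p p∤y y²≋1 = ≋-canonical (quotient<p 1 y) y<p (begin
    quotient 1 y           ≡⟨ *-identityˡ (quotient 1 y) ⟨
    1 * quotient 1 y       ≈⟨ ≋-* y²≋1 (≋-refl {quotient 1 y}) ⟨
    y * y * quotient 1 y   ≡⟨ *-assoc y y (quotient 1 y) ⟩
    y * (y * quotient 1 y) ≈⟨ ≋-* (≋-refl {y}) (*-quotient p∤y) ⟩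
    y * 1                  ≡⟨ *-identityʳ y ⟩
    y                      ∎)
    where open ≋-Reasoning

  inner : List ℕ
  inner = interval 2 (2 * n ∸ 2)

  ∈-inner⁻ : ∀ {x} → x ∈ inner → x ∈ units × x ≢ 1 × x ≢ 2 * n
  ∈-inner⁻ {x} x∈ with 2≤x , x<2+k ← ∈-interval⁻ x∈ =
    ∈-interval⁺ (≤-trans (n≤1+n 1) 2≤x) (<-trans x<2n′ ≤-refl) ,
    (λ { refl → 1+n≰n 2≤x }) ,
    (λ { refl → <-irrefl refl x<2n′ })
    where
    x<2n′ : x < 2 * n
    x<2n′ = subst (x <_) (m+[n∸m]≡n 2≤2n) x<2+k

  ∈-inner⁺ : ∀ {x} → x ∈ units → x ≢ 1 → x ≢ 2 * n → x ∈ inner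
  ∈-inner⁺ {x} x∈ x≢1 x≢2n with 1≤x , x<p ← ∈-units x∈ =
    ∈-interval⁺ (≤∧≢⇒< 1≤x (x≢1 ∘ sym)) (subst (x <_) (sym (m+[n∸m]≡n 2≤2n)) (≤∧≢⇒< (s≤s⁻¹ x<p) x≢2n))

  ∏units≡∏inner*2n : product units ≡ product inner * (2 * n)
  ∏units≡∏inner*2n = begin
    product (interval 1 (2 * n))                 ≡⟨ cong (λ k → product (interval 1 k)) (m+[n∸m]≡n 2≤2n) ⟨
    product (interval 1 (2 + k))                 ≡⟨ cong product (interval-∷ 1 (1 + k)) ⟩
    1 * product (interval 2 (1 + k))             ≡⟨ *-identityˡ _ ⟩
    product (interval 2 (1 + k))                 ≡⟨ cong product (interval-∷ʳ 2 k) ⟩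
    product (inner ++ (2 + k) ∷ [])              ≡⟨ product-++ inner ((2 + k) ∷ []) ⟩
    product inner * ((2 + k) * 1)                ≡⟨ cong (λ t → product inner * t) (trans (*-identityʳ (2 + k)) (m+[n∸m]≡n 2≤2n)) ⟩
    product inner * (2 * n)                      ∎
    where
    open ≡-Reasoning
    k = 2 * n ∸ 2

  inverse-pairing : Pairing 1 inner
  inverse-pairing = record
    { partner    = quotient 1
    ; partner-∈  = into
    ; partner-≢  = no-fixed-point
    ; involutive = λ x∈ → quotient-involutive p∤1 (p∤inner x∈) (<inner x∈)
    ; partner-*  = λ x∈ → *-quotient (p∤inner x∈)
    }
    where
    p∤1 : ¬ (p ∣ℕ 1)
    p∤1 = p∤ ≤-refl 1<p
    p∤inner : ∀ {x} → x ∈ inner → ¬ (p ∣ℕ x)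
    p∤inner x∈ = p∤unit (proj₁ (∈-inner⁻ x∈))
    <inner : ∀ {x} → x ∈ inner → x < p
    <inner x∈ = proj₂ (∈-units (proj₁ (∈-inner⁻ x∈)))
    into : ∀ {x} → x ∈ inner → quotient 1 x ∈ inner
    into {x} x∈ with x∈units , x≢1 , x≢2n ← ∈-inner⁻ x∈ =
      ∈-inner⁺ (quotient-∈units p∤1 (p∤inner x∈))
        (λ q≡1  → x≢1  (trans (sym back) (trans (cong (quotient 1) q≡1)  (self-inverse 1<p p∤1 ≋-refl))))
        (λ q≡2n → x≢2n (trans (sym back) (trans (cong (quotient 1) q≡2n) (self-inverse ≤-refl p∤2n minus-one²))))
      where
      -- 1/x = ±1 would force x = 1/(1/x) = ±1
      back : quotient 1 (quotient 1 x) ≡ x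
      back = quotient-involutive p∤1 (p∤inner x∈) (<inner x∈)
      p∤2n : ¬ (p ∣ℕ 2 * n)
      p∤2n = p∤ (<⇒≤ 2≤2n) ≤-refl
    no-fixed-point : ∀ {x} → x ∈ inner → quotient 1 x ≢ x
    no-fixed-point {x} x∈ q≡x with ∈-inner⁻ x∈
    ... | x∈units , x≢1 , x≢2n with 1≤x , x<p ← ∈-units x∈units =
      [ x≢1 , x≢2n ] (square-root-of-one 1≤x x<p (subst (λ y → x * y ≋ 1) q≡x (*-quotient (p∤inner x∈))))

  wilson : product units ≋ 2 * n
  wilson with k , _ , ∏inner≋1ᵏ ← pairing-product inner (interval-unique 2 (2 * n ∸ 2)) inverse-pairing = begin
    product units            ≡⟨ ∏units≡∏inner*2n ⟩
    product inner * (2 * n)  ≈⟨ ≋-* ∏inner≋1ᵏ (≋-refl {2 * n}) ⟩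
    1 ^ k * (2 * n)          ≡⟨ cong (_* (2 * n)) (^-zeroˡ k) ⟩
    1 * (2 * n)              ≡⟨ *-identityˡ (2 * n) ⟩
    2 * n                    ∎
    where open ≋-Reasoning

  square-root : ∀ {b} → isSquareMod b p ≡ true → ∃ λ x → x * x ≋ b
  square-root {b} sq with x , x²≡b ← satisfied (any⁻ _ (upTo p) (subst T (sym sq) tt)) =
    x , mk≋ (≡ᵇ⇒≡ _ _ x²≡b)

  no-square-root : ∀ {b x} → isSquareMod b p ≡ false → x < p → ¬ (x * x ≋ b)
  no-square-root nsq x<p (mk≋ x²≡b) = subst T nsq (any⁺ _ (lose (∈-upTo⁺ x<p) (≡⇒≡ᵇ _ _ x²≡b)))

  euler-square : ∀ {b} → ¬ (p ∣ℕ b) → isSquareMod b p ≡ true → b ^ n ≋ 1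
  euler-square {b} p∤b sq with x , x²≋b ← square-root sq = begin
    b ^ n                ≈⟨ ≋-^ n x²≋b ⟨
    (x * x) ^ n          ≡⟨ cong (λ y → (x * y) ^ n) (*-identityʳ x) ⟨
    (x ^ 2) ^ n          ≡⟨ ^-*-assoc x 2 n ⟩
    x ^ (2 * n)          ≈⟨ fermat p∤x ⟩
    1                    ∎
    where
    open ≋-Reasoning
    p∤x : ¬ (p ∣ℕ x)
    p∤x p∣x = p∤b (≋0⇒∣ (≋-trans (≋-sym x²≋b) (≋-* (∣⇒≋0 p∣x) (≋-refl {x}))))

  division-pairing : ∀ {b} → ¬ (p ∣ℕ b) → isSquareMod b p ≡ false → Pairing b units
  division-pairing {b} p∤b nsq = record
    { partner    = quotient b
    ; partner-∈  = λ x∈ → quotient-∈units p∤b (p∤unit x∈)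
    ; partner-≢  = λ {x} x∈ q≡x →
        no-square-root nsq (proj₂ (∈-units x∈)) (subst (λ y → x * y ≋ b) q≡x (*-quotient (p∤unit x∈)))
    ; involutive = λ x∈ → quotient-involutive p∤b (p∤unit x∈) (proj₂ (∈-units x∈))
    ; partner-*  = λ x∈ → *-quotient (p∤unit x∈)
    }

  euler-nonsquare : ∀ {b} → ¬ (p ∣ℕ b) → isSquareMod b p ≡ false → b ^ n ≋ 2 * n
  euler-nonsquare {b} p∤b nsq
    with k , |units|≡k+k , ∏units≋bᵏ ← pairing-product units (interval-unique 1 (2 * n)) (division-pairing p∤b nsq)
    = begin
      b ^ n          ≡⟨ cong (b ^_) k≡n ⟨
      b ^ k          ≈⟨ ∏units≋bᵏ ⟨
      product units  ≈⟨ wilson ⟩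
      2 * n          ∎
    where
    open ≋-Reasoning
    k≡n : k ≡ n
    k≡n = *-cancelˡ-≡ k n 2 (trans (cong (_+_ k) (+-identityʳ k))
            (trans (sym |units|≡k+k) (length-interval 1 (2 * n))))

  minus-one-power : ∀ g → (2 * n) ^ g ≋ (2 * n) ^ (g % 2)
  minus-one-power g = begin
    (2 * n) ^ g                                ≡⟨ cong ((2 * n) ^_) (m≡m%n+[m/n]*n g 2) ⟩
    (2 * n) ^ (g % 2 + g / 2 * 2)              ≡⟨ ^-distribˡ-+-* (2 * n) (g % 2) (g / 2 * 2) ⟩
    (2 * n) ^ (g % 2) * (2 * n) ^ (g / 2 * 2)  ≡⟨ cong (λ k → (2 * n) ^ (g % 2) * (2 * n) ^ k) (*-comm (g / 2) 2) ⟩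
    (2 * n) ^ (g % 2) * (2 * n) ^ (2 * (g / 2)) ≡⟨ cong ((2 * n) ^ (g % 2) *_) (^-*-assoc (2 * n) 2 (g / 2)) ⟨
    (2 * n) ^ (g % 2) * ((2 * n) ^ 2) ^ (g / 2) ≈⟨ ≋-* (≋-refl {(2 * n) ^ (g % 2)}) (≋-^ (g / 2) square≋1) ⟩
    (2 * n) ^ (g % 2) * 1 ^ (g / 2)            ≡⟨ cong ((2 * n) ^ (g % 2) *_) (^-zeroˡ (g / 2)) ⟩
    (2 * n) ^ (g % 2) * 1                      ≡⟨ *-identityʳ _ ⟩
    (2 * n) ^ (g % 2)                          ∎
    where
    open ≋-Reasoning
    square≋1 : (2 * n) ^ 2 ≋ 1
    square≋1 = ≋-trans (≋-reflexive (cong (2 * n *_) (*-identityʳ (2 * n)))) minus-one²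

  odd-multiple : ∀ q → q * p ≋₂ q
  odd-multiple q = Mod2.≋-trans (Mod2.≋-reflexive (q*p≡q+[q*n]*2 q n)) (Mod2.+-multiple-≋ q (q * n))
    where
    q*p≡q+[q*n]*2 : ∀ q n → q * suc (2 * n) ≡ q + q * n * 2
    q*p≡q+[q*n]*2 = solve-∀

  odd-complement : ∀ a → a ≤ p → a ≋₂ (p ∸ a) + 1
  odd-complement a a≤p = begin
    a                   ≈⟨ Mod2.+-multiple-≋ a s ⟨
    a + s * 2           ≡⟨ a+s*2≡[a+s]+s a s ⟩
    (a + s) + s         ≡⟨ cong (_+ s) (m+[n∸m]≡n a≤p) ⟩
    p + s               ≡⟨ p+s≡s+1+n*2 n s ⟩
    (s + 1) + n * 2     ≈⟨ Mod2.+-multiple-≋ (s + 1) n ⟩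
    s + 1               ∎
    where
    open Mod2.≋-Reasoning
    s = p ∸ a
    a+s*2≡[a+s]+s : ∀ a s → a + s * 2 ≡ (a + s) + s
    a+s*2≡[a+s]+s = solve-∀
    p+s≡s+1+n*2 : ∀ n s → suc (2 * n) + s ≡ (s + 1) + n * 2
    p+s≡s+1+n*2 = solve-∀

  lower-half : ∀ {a} → a ≤ n → (2 * a <ᵇ p) ≡ true
  lower-half a≤n = <ᵇ-true (s≤s (*-monoʳ-≤ 2 a≤n))

  upper-half : ∀ {a} → n < a → (2 * a <ᵇ p) ≡ false
  upper-half {a} n<a = <ᵇ-false (≤-trans (n≤1+n p) (subst (_≤ 2 * a) (*-suc 2 n) (*-monoʳ-≤ 2 n<a)))

  legendre-unit : ∀ {b} → 1 ≤ b → b < p → legendre b p ≡ (if isSquareMod b p then + 1 else - (+ 1))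
  legendre-unit {suc _} _ b<p rewrite m<n⇒m%n≡m b<p = refl

  reflect-upper : ∀ {a} → n < a → p ∸ a ≤ n
  reflect-upper {a} n<a = subst (p ∸ a ≤_) (trans (m+n∸m≡n n (n + 0)) (+-identityʳ n)) (∸-monoʳ-≤ p n<a)

  reflect-lower : ∀ {a} → a ≤ n → n < p ∸ a
  reflect-lower {a} a≤n = subst (_≤ p ∸ a) p∸n≡1+n (∸-monoʳ-≤ p a≤n)
    where
    p∸n≡1+n : p ∸ n ≡ suc n
    p∸n≡1+n = begin
      suc (n + (n + 0)) ∸ n ≡⟨ cong (_∸ n) (+-suc n (n + 0)) ⟨
      n + suc (n + 0) ∸ n   ≡⟨ m+n∸m≡n n (suc (n + 0)) ⟩
      suc (n + 0)           ≡⟨ cong suc (+-identityʳ n) ⟩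
      suc n                 ∎
      where open ≡-Reasoning

  module Gauss (b : ℕ) (p∤b : ¬ (p ∣ℕ b)) where

    r : ℕ → ℕ
    r x = res (x * b) p

    small : ℕ → Bool
    small x = 2 * r x <ᵇ p

    σ : ℕ → ℕ
    σ x = if small x then r x else p ∸ r x

    G : ℕ
    G = ∑ halves (λ x → 𝟙 (not (small x)))

    r<p : ∀ x → r x < p
    r<p x = m%n<n (x * b) p

    r-pos : ∀ {x} → x ∈ halves → 1 ≤ r x
    r-pos x∈ = residue-pos (p∤* (p∤unit (halves⊆units x∈)) p∤b)

    σ-∈ : ∀ {x} → x ∈ halves → σ x ∈ halves
    σ-∈ {x} x∈ with ≤-<-connex (r x) n
    ... | inj₁ r≤n rewrite lower-half r≤n = ∈-interval⁺ (r-pos x∈) (s≤s r≤n)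
    ... | inj₂ n<r rewrite upper-half n<r = ∈-interval⁺ (m<n⇒0<n∸m (r<p x)) (s≤s (reflect-upper n<r))

    <p : ∀ {x} → x ∈ halves → x < p
    <p x∈ = proj₂ (∈-units (halves⊆units x∈))

    -- For x, y ∈ {1, …, n} the residues of xb and yb never add up to p,
    -- since p ∤ x + y.
    no-complement : ∀ {x y} → x ∈ halves → y ∈ halves → r x + r y ≢ p
    no-complement {x} {y} x∈ y∈ rx+ry≡p =
      [ p∤ 1≤x+y x+y<p , p∤b ] (euclidsLemma (x + y) b p-prime (≋0⇒∣ [x+y]b≋0))
      where
      1≤x+y : 1 ≤ x + y
      1≤x+y = ≤-trans (proj₁ (∈-halves x∈)) (m≤m+n x y)
      x+y<p : x + y < p
      x+y<p = s≤s (+-mono-≤ (proj₂ (∈-halves x∈)) (≤-trans (proj₂ (∈-halves y∈)) (m≤m+n n 0)))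
      [x+y]b≋0 : (x + y) * b ≋ 0
      [x+y]b≋0 = begin
        (x + y) * b    ≡⟨ *-distribʳ-+ b x y ⟩
        x * b + y * b  ≈⟨ ≋-+ (%-≋ (x * b)) (%-≋ (y * b)) ⟨
        r x + r y      ≡⟨ rx+ry≡p ⟩
        p              ≈⟨ ∣⇒≋0 ∣-refl ⟩
        0              ∎
        where open ≋-Reasoning

    r-injective : ∀ {x y} → x ∈ halves → y ∈ halves → r x ≡ r y → x ≡ y
    r-injective x∈ y∈ = *-injective p∤b (<p x∈) (<p y∈)

    σ-injective : ∀ {x y} → x ∈ halves → y ∈ halves → σ x ≡ σ y → x ≡ y
    σ-injective {x} {y} x∈ y∈ with ≤-<-connex (r x) n | ≤-<-connex (r y) n
    ... | inj₁ rx≤n | inj₁ ry≤n rewrite lower-half rx≤n | lower-half ry≤n = r-injective x∈ y∈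
    ... | inj₂ n<rx | inj₂ n<ry rewrite upper-half n<rx | upper-half n<ry =
      λ e → r-injective x∈ y∈ (∸-cancelˡ-≡ (<⇒≤ (r<p x)) (<⇒≤ (r<p y)) e)
    -- in the mixed cases {xb}_p + {yb}_p would be p
    ... | inj₁ rx≤n | inj₂ n<ry rewrite lower-half rx≤n | upper-half n<ry =
      λ e → ⊥-elim (no-complement x∈ y∈ (trans (cong (_+ r y) e) (m∸n+n≡m (<⇒≤ (r<p y)))))
    ... | inj₂ n<rx | inj₁ ry≤n rewrite upper-half n<rx | lower-half ry≤n =
      λ e → ⊥-elim (no-complement y∈ x∈ (trans (cong (_+ r x) (sym e)) (m∸n+n≡m (<⇒≤ (r<p x)))))

    σ-permutes : map σ halves ↭ halves
    σ-permutes = injection⇒↭ σ (interval-unique 1 n) σ-∈ σ-injective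

    sign : ℕ → ℕ
    sign x = if small x then 1 else 2 * n

    r≋sign*σ : ∀ x → r x ≋ sign x * σ x
    r≋sign*σ x with small x
    ... | true  = ≋-reflexive (sym (+-identityʳ (r x)))
    ... | false = ≋-sym (minus-one-* (r x) (r<p x))

    -- Multiply xb ≋ sign(x) · σ(x) over x ∈ {1, …, n} and cancel ∏σ(x) = n!.
    gauss-lemma : b ^ n ≋ (2 * n) ^ G
    gauss-lemma = ∏-cancelˡ-≋ halves (λ x∈ → p∤unit (halves⊆units x∈)) (begin
      product halves * b ^ n                  ≡⟨ cong (λ k → product halves * b ^ k) (length-interval 1 n) ⟨
      product halves * b ^ length halves      ≡⟨ ∏-scale b halves ⟨
      ∏ halves (λ x → x * b)                  ≈⟨ ∏-≋ halves (λ {x} _ → ≋-sym (%-≋ (x * b))) ⟩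
      ∏ halves r                              ≈⟨ ∏-≋ halves (λ {x} _ → r≋sign*σ x) ⟩
      ∏ halves (λ x → sign x * σ x)           ≡⟨ ∏-* sign σ halves ⟩
      ∏ halves sign * ∏ halves σ              ≡⟨ cong₂ _*_ (∏-indicator (2 * n) small halves) (product-↭ σ-permutes) ⟩
      (2 * n) ^ G * product halves            ≡⟨ *-comm ((2 * n) ^ G) (product halves) ⟩
      product halves * (2 * n) ^ G            ∎)
      where open ≋-Reasoning

    square⇒G-even : isSquareMod b p ≡ true → G % 2 ≡ 0
    square⇒G-even sq with parity G
    ... | inj₁ G-even = G-even
    ... | inj₂ G-odd  = contradiction (begin
      1                   ≈⟨ euler-square p∤b sq ⟨
      b ^ n               ≈⟨ gauss-lemma ⟩
      (2 * n) ^ G         ≈⟨ minus-one-power G ⟩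
      (2 * n) ^ (G % 2)   ≡⟨ cong (λ k → (2 * n) ^ k) G-odd ⟩
      (2 * n) ^ 1         ≡⟨ *-identityʳ (2 * n) ⟩
      2 * n               ∎) 1≉minus-one
      where open ≋-Reasoning

    nonsquare⇒G-odd : isSquareMod b p ≡ false → G % 2 ≡ 1
    nonsquare⇒G-odd nsq with parity G
    ... | inj₂ G-odd  = G-odd
    ... | inj₁ G-even = contradiction (begin
      1                   ≡⟨ cong (λ k → (2 * n) ^ k) G-even ⟨
      (2 * n) ^ (G % 2)   ≈⟨ minus-one-power G ⟨
      (2 * n) ^ G         ≈⟨ gauss-lemma ⟨
      b ^ n               ≈⟨ euler-nonsquare p∤b nsq ⟩
      2 * n               ∎) 1≉minus-one
      where open ≋-Reasoning

    S : ℕ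
    S = ∑ halves (λ x → x * b / p)

    r-parity : ∀ x → r x ≋₂ σ x + 𝟙 (not (small x))
    r-parity x with small x
    ... | true  = Mod2.≋-reflexive (sym (+-identityʳ (r x)))
    ... | false = odd-complement (r x) (<⇒≤ (r<p x))

    gauss-sum-parity : b * sum halves ≋₂ sum halves + G + S
    gauss-sum-parity = begin
      b * sum halves                                         ≡⟨ cong (b *_) (cong sum (map-id halves)) ⟨
      b * ∑ halves id                                        ≡⟨ ∑-*ˡ b id halves ⟨
      ∑ halves (λ x → b * x)                                 ≡⟨ ∑-cong halves (λ {x} _ → divide x) ⟩
      ∑ halves (λ x → r x + x * b / p * p)                   ≈⟨ Mod2.∑-≋ halves (λ {x} _ → reduce x) ⟩
      ∑ halves (λ x → σ x + 𝟙 (not (small x)) + x * b / p)   ≡⟨ ∑-+ _ _ halves ⟩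
      ∑ halves (λ x → σ x + 𝟙 (not (small x))) + S           ≡⟨ cong (_+ S) (∑-+ σ _ halves) ⟩
      ∑ halves σ + G + S                                     ≡⟨ cong (λ t → t + G + S) (sum-↭ σ-permutes) ⟩
      sum halves + G + S                                     ∎
      where
      open Mod2.≋-Reasoning
      divide : ∀ x → b * x ≡ r x + x * b / p * p
      divide x = trans (*-comm b x) (m≡m%n+[m/n]*n (x * b) p)
      reduce : ∀ x → r x + x * b / p * p ≋₂ σ x + 𝟙 (not (small x)) + x * b / p
      reduce x = Mod2.≋-+ (r-parity x) (odd-multiple (x * b / p))

    legendre-parity : 1 ≤ b → b < p →
      (legendre b p ≡ + 1 × G % 2 ≡ 0) ⊎ (legendre b p ≡ - (+ 1) × G % 2 ≡ 1)
    legendre-parity 1≤b b<p rewrite legendre-unit 1≤b b<p with isSquareMod b p in sq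
    ... | true  = inj₁ (refl , square⇒G-even sq)
    ... | false = inj₂ (refl , nonsquare⇒G-odd sq)

  module Counts (c : ℕ) (1≤c : 1 ≤ c) (c<2n : c < 2 * n) where

    a : ℕ
    a = p ∸ c

    c<p : c < p
    c<p = <-trans c<2n ≤-refl

    module J = Gauss (suc c) (p∤ (s≤s z≤n) (s≤s c<2n))
    module C = Gauss c (p∤ 1≤c c<p)
    module A = Gauss a (p∤ (m<n⇒0<n∸m c<p) (∸-monoʳ-< 1≤c (<⇒≤ c<p)))

    D M : ℕ
    D = ∑ halves (λ x → 𝟙 (J.r x <ᵇ x))
    M = ∑ halves (λ x → 𝟙 ((x <ᵇ J.r x) ∧ J.small x))

    -- {xj}_p ≠ x, since j ≢ 1 (mod p).
    r≢id : ∀ {x} → x ∈ halves → J.r x ≢ x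
    r≢id {x} x∈ r≡x = <⇒≢ (s≤s 1≤c) (sym (≋-canonical (s≤s c<2n) 1<p j≋1))
      where
      open ≋-Reasoning
      j≋1 : suc c ≋ 1
      j≋1 = *-cancelʳ-≋ p-prime (p∤unit (halves⊆units x∈)) (begin
        suc c * x   ≡⟨ *-comm (suc c) x ⟩
        x * suc c   ≈⟨ %-≋ (x * suc c) ⟨
        J.r x       ≡⟨ r≡x ⟩
        x           ≡⟨ *-identityˡ x ⟨
        1 * x       ∎)

    trichotomy : ∀ {x} → x ∈ halves →
      𝟙 (J.r x <ᵇ x) + 𝟙 ((x <ᵇ J.r x) ∧ J.small x) + 𝟙 (not (J.small x)) ≡ 1
    trichotomy {x} x∈ with <-cmp (J.r x) x
    ... | tri≈ _ r≡x _ = contradiction r≡x (r≢id x∈)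
    ... | tri< r<x _ _ rewrite <ᵇ-true r<x | <ᵇ-false (<⇒≤ r<x)
                             | lower-half (≤-trans (<⇒≤ r<x) (proj₂ (∈-halves x∈))) = refl
    ... | tri> _ _ x<r rewrite <ᵇ-false (<⇒≤ x<r) | <ᵇ-true x<r with J.small x
    ...   | true  = refl
    ...   | false = refl

    partition : D + M + J.G ≡ n
    partition = begin
      D + M + J.G                  ≡⟨ cong (_+ J.G) (∑-+ _ _ halves) ⟨
      ∑ halves _ + J.G             ≡⟨ ∑-+ _ _ halves ⟨
      ∑ halves _                   ≡⟨ ∑-cong halves trichotomy ⟩
      ∑ halves (λ _ → 1)           ≡⟨ ∑-count halves ⟩
      length halves                ≡⟨ length-interval 1 n ⟩
      n                            ∎
      where open ≡-Reasoning

    -- ⌊xj/p⌋ = ⌊xc/p⌋ + [x is a descent], since xj = xc + x.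
    floor-step : J.S ≡ C.S + D
    floor-step = trans (∑-cong halves step) (∑-+ _ _ halves)
      where
      step : ∀ {x} → x ∈ halves → x * suc c / p ≡ x * c / p + 𝟙 (J.r x <ᵇ x)
      step {x} x∈ rewrite *-suc x c | +-comm x (x * c) = /-step p (x * c) x (C.<p x∈)

    complement : ∀ {x} → x ∈ halves → A.r x ≡ p ∸ C.r x
    complement {x} x∈ =
      ≋-canonical (A.r<p x) (∸-monoʳ-< (C.r-pos x∈) (<⇒≤ (C.r<p x))) (+-cancelˡ-≋ (C.r x) (begin
        C.r x + A.r x       ≈⟨ ≋-+ (%-≋ (x * c)) (%-≋ (x * a)) ⟩
        x * c + x * a       ≡⟨ *-distribˡ-+ x c a ⟨
        x * (c + a)         ≡⟨ cong (x *_) (m+[n∸m]≡n (<⇒≤ c<p)) ⟩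
        x * p               ≈⟨ ∣⇒≋0 (n∣m*n x) ⟩
        0                   ≈⟨ ∣⇒≋0 ∣-refl ⟨
        p                   ≡⟨ m+[n∸m]≡n (<⇒≤ (C.r<p x)) ⟨
        C.r x + (p ∸ C.r x) ∎))
      where open ≋-Reasoning

    -- Hence exactly one of xc, xa has residue above p/2.
    complementary-counts : C.G + A.G ≡ n
    complementary-counts = begin
      C.G + A.G           ≡⟨ ∑-+ _ _ halves ⟨
      ∑ halves _          ≡⟨ ∑-cong halves one-of-two ⟩
      ∑ halves (λ _ → 1)  ≡⟨ ∑-count halves ⟩
      length halves       ≡⟨ length-interval 1 n ⟩
      n                   ∎
      where
      open ≡-Reasoning
      one-of-two : ∀ {x} → x ∈ halves → 𝟙 (not (C.small x)) + 𝟙 (not (A.small x)) ≡ 1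
      one-of-two {x} x∈ rewrite complement x∈ with ≤-<-connex (C.r x) n
      ... | inj₁ r≤n rewrite lower-half r≤n | upper-half (reflect-lower r≤n) = refl
      ... | inj₂ n<r rewrite upper-half n<r | lower-half (reflect-upper n<r) = refl

    -- Comparing Gauss's sums for j = c + 1 and for c through the floor step:
    -- N + G_c ≡ G_j + D (mod 2), where N = 1 + ⋯ + n.
    jc-relation : sum halves + C.G ≋₂ J.G + D
    jc-relation = Mod2.+-cancelˡ-≋ (N + C.S) (begin
      (N + C.S) + (N + C.G)   ≡⟨ regroup₁ N C.S C.G ⟩
      N + (N + C.G + C.S)     ≈⟨ Mod2.≋-+ (Mod2.≋-refl {N}) C.gauss-sum-parity ⟨
      suc c * N               ≈⟨ J.gauss-sum-parity ⟩
      N + J.G + J.S           ≡⟨ cong (_+_ (N + J.G)) floor-step ⟩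
      N + J.G + (C.S + D)     ≡⟨ regroup₂ N J.G C.S D ⟩
      (N + C.S) + (J.G + D)   ∎)
      where
      open Mod2.≋-Reasoning
      N = sum halves
      regroup₁ : ∀ N S G → (N + S) + (N + G) ≡ N + (N + G + S)
      regroup₁ = solve-∀
      regroup₂ : ∀ N G S D → N + G + (S + D) ≡ (N + S) + (G + D)
      regroup₂ = solve-∀

    -- The heart of the argument: |M_p(j)| + G_a ≡ N (mod 2), obtained from
    -- jc-relation by eliminating D, G_j and G_c with the partition and G_c + G_a = n.
    key-parity : M + A.G ≋₂ sum halves
    key-parity = Mod2.+-cancelˡ-≋ (N + C.G) (begin
      (N + C.G) + (M + A.G)   ≈⟨ Mod2.≋-+ jc-relation (Mod2.≋-refl {M + A.G}) ⟩
      (J.G + D) + (M + A.G)   ≡⟨ regroup₁ J.G D M A.G ⟩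
      (D + M + J.G) + A.G     ≡⟨ cong (_+ A.G) partition ⟩
      n + A.G                 ≡⟨ cong (_+ A.G) complementary-counts ⟨
      C.G + A.G + A.G         ≡⟨ regroup₂ C.G A.G ⟩
      C.G + A.G * 2           ≈⟨ Mod2.+-multiple-≋ C.G A.G ⟩
      C.G                     ≈⟨ Mod2.+-multiple-≋ C.G N ⟨
      C.G + N * 2             ≡⟨ regroup₃ C.G N ⟩
      (N + C.G) + N           ∎)
      where
      open Mod2.≋-Reasoning
      N = sum halves
      regroup₁ : ∀ G D M A → (G + D) + (M + A) ≡ (D + M + G) + A
      regroup₁ = solve-∀
      regroup₂ : ∀ G A → G + A + A ≡ G + A * 2
      regroup₂ = solve-∀
      regroup₃ : ∀ G N → G + N * 2 ≡ (N + G) + N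
      regroup₃ = solve-∀

    |Mp|≡M : length (Mp p (suc c)) ≡ M
    |Mp|≡M = trans (cong (λ k → length (filterᵇ in-M (map suc (upTo k)))) (trans (cong (_/ 2) (*-comm 2 n)) (m*n/n≡m n 2)))
                   (length-filter in-M halves)
      where
      in-M : ℕ → Bool
      in-M x = (x <ᵇ J.r x) ∧ J.small x

    theorem : + 2 ∣ (+ length (Mp p (suc c)) -ℤ
                      (((legendre ((p + 1) ∸ suc c) p -ℤ + 1) /ℕ 2) +ℤ + ((p * p ∸ 1) / 8)))
    theorem rewrite |Mp|≡M | cong (_∸ c) (+-comm (2 * n) 1) | p²-1/8≡∑halves =
      legendre-parity⇒∣ M (sum halves) A.G (legendre a p)
        (A.legendre-parity (m<n⇒0<n∸m c<p) (∸-monoʳ-< 1≤c (<⇒≤ c<p))) key-parity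

  theorem-for-odd-prime : ∀ j → 2 ≤ j → j ≤ 2 * n →
    + 2 ∣ (+ length (Mp p j) -ℤ (((legendre ((p + 1) ∸ j) p -ℤ + 1) /ℕ 2) +ℤ + ((p * p ∸ 1) / 8)))
  theorem-for-odd-prime (suc c) (s≤s 1≤c) j≤2n = Counts.theorem c 1≤c j≤2n

odd-prime : ∀ {p} → Prime p → 2 < p → ∃ λ n → p ≡ suc (2 * n)
odd-prime {p} p-prime 2<p with parity p
... | inj₂ p%2≡1 = p / 2 , trans (m≡m%n+[m/n]*n p 2) (cong₂ _+_ p%2≡1 (*-comm (p / 2) 2))
... | inj₁ p%2≡0 with prime⇒irreducible p-prime (m%n≡0⇒n∣m p 2 p%2≡0)
...   | inj₁ ()
...   | inj₂ 2≡p = contradiction 2<p (<-irrefl 2≡p)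

theorem2p1 : (p j : ℕ) → .{{_ : NonZero p}} → Prime p → 3 < p → 2 ≤ j → j ≤ p ∸ 1 →
    (+ 2) ∣ ((+ length (Mp p j)) -ℤ (((legendre ((p + 1) ∸ j) p -ℤ + 1) /ℕ 2) +ℤ (+ ((p * p ∸ 1) / 8))))
theorem2p1 p j p-prime 3<p 2≤j j≤p-1 with n , refl ← odd-prime p-prime (<⇒≤ 3<p) =
  OddPrime.theorem-for-odd-prime n p-prime j 2≤j j≤p-1
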